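{- Let $p$ be a prime and define $a\in\mathbb{F}_p(x,y,z)^{\mathbb{N}}$ by $$a(n)=(x+y+z)^n-(x+y)^n-(x+z)^n-(y+z)^n+x^n+y^n+z^n.$$ Then $\mathcal{Z}(a)=\{p^n:n\in\mathbb{N}\}\cup\{p^n+p^m:n,m\in\mathbb{N}\}$.
   Context: $\mathbb{N}=\{0,1,2,\dots\}$; $\mathbb{F}_p(x,y,z)$ is the rational function field in three variables over the field with $p$ elements; $\mathcal{Z}(a)=\{n\in\mathbb{N}:a(n)=0\}$. -}

module Defs where

open import Data.Nat as ℕ using (ℕ; zero; suc; _∸_; _≟_)
open import Data.Integer as ℤ using (ℤ; +_; _+_; _*_; -_; _-_)
open import Data.Integer.Divisibility using (_∣_)
open import Relation.Nullary using (yes; no)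

-- Polynomials in three variables x, y, z with integer coefficients,
-- represented by their coefficient function: P i j k = coefficient of x^i y^j z^k.
-- (Only finitely supported functions arise from the constructions below.)
Poly : Set
Poly = ℕ → ℕ → ℕ → ℤ

sumTo : ℕ → (ℕ → ℤ) → ℤ
sumTo zero    f = f 0
sumTo (suc n) f = sumTo n f + f (suc n)

δ : ℕ → ℕ → ℤ
δ m n with m ≟ n
... | yes _ = + 1
... | no  _ = + 0

mono : ℕ → ℕ → ℕ → Poly
mono a b c i j k = δ a i * (δ b j * δ c k)

one X Y Z : Poly
one = mono 0 0 0
X = mono 1 0 0
Y = mono 0 1 0
Z = mono 0 0 1

_⊕_ : Poly → Poly → Poly
(f ⊕ g) i j k = f i j k + g i j k

_⊖_ : Poly → Poly → Poly
(f ⊖ g) i j k = f i j k - g i j k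

infixl 6 _⊕_ _⊖_
infixl 7 _⊛_
infixr 8 _^ᵖ_

_⊛_ : Poly → Poly → Poly
(f ⊛ g) i j k =
  sumTo i λ a → sumTo j λ b → sumTo k λ c →
    f a b c * g (i ∸ a) (j ∸ b) (k ∸ c)

_^ᵖ_ : Poly → ℕ → Poly
f ^ᵖ zero  = one
f ^ᵖ suc n = f ⊛ (f ^ᵖ n)

seqA : ℕ → Poly
seqA n = (X ⊕ Y ⊕ Z) ^ᵖ n ⊖ (X ⊕ Y) ^ᵖ n ⊖ (X ⊕ Z) ^ᵖ n ⊖ (Y ⊕ Z) ^ᵖ n
         ⊕ X ^ᵖ n ⊕ Y ^ᵖ n ⊕ Z ^ᵖ n

-- The image of an integer polynomial in 𝔽_p[x,y,z] ⊂ 𝔽_p(x,y,z) is zero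
-- iff every coefficient is divisible by p.
IsZeroModP : ℕ → Poly → Set
IsZeroModP p f = ∀ i j k → + p ∣ f i j k

InZeroSet : ℕ → ℕ → Set
InZeroSet p n = IsZeroModP p (seqA n)

module Submission where

-- Expanding the powers, the coefficient of x^i y^j z^k in a(n) is, by inclusion–exclusion over the
-- seven linear forms, the trinomial coefficient n! / (i! j! k!) when i, j, k are all positive or all
-- zero, and 0 otherwise. So n ∈ 𝒵(a) iff n > 0 and p divides binom i (j + k) · binom j k whenever
-- i, j, k > 0 and i + j + k = n. By Kummer's theorem p ∤ binom a b iff a + b has no carry in base p,
-- which we derive from the last-digit case of Lucas' theorem. Finally n splits into three positive
-- summands without carries iff its base-p digit sum is at least 3, i.e. iff n is neither p ^ m nor
-- p ^ m + p ^ l; both directions go digit by digit.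

open import Defs
open import Data.Bool using (Bool; true; false)
open import Data.Empty using (⊥; ⊥-elim)
open import Data.Integer using (ℤ; +_)
open import Data.Nat using (ℕ; zero; suc; _∸_; _≤_; _<_; z≤n; s≤s; z<s; s<s; _≤?_)
open import Relation.Binary.PropositionalEquality
open import Relation.Nullary using (yes; no; ¬_)

module Coefficients where
  open import Data.Nat using (_≟_)
  open import Data.Nat.Properties using (≰⇒>; ≤-antisym; <⇒≢; n<1+n; <⇒≱; <-trans; ≤-reflexive)
  open import Data.Integer using (_+_; _*_; _-_)
  open import Data.Integer.Properties
    using (*-identityˡ; +-identityˡ; +-identityʳ; *-zeroʳ; *-distribˡ-+; *-distribʳ-+)
  open import Data.Integer.Tactic.RingSolver using (solve-∀)

  sumTo-cong : ∀ n {f g : ℕ → ℤ} → (∀ a → f a ≡ g a) → sumTo n f ≡ sumTo n g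
  sumTo-cong zero    f≗g = f≗g 0
  sumTo-cong (suc n) f≗g = cong₂ _+_ (sumTo-cong n f≗g) (f≗g (suc n))

  sumTo-+ : ∀ n (f g : ℕ → ℤ) → sumTo n (λ a → f a + g a) ≡ sumTo n f + sumTo n g
  sumTo-+ zero    f g = refl
  sumTo-+ (suc n) f g = begin
    sumTo n (λ a → f a + g a) + (f (suc n) + g (suc n))
      ≡⟨ cong (_+ (f (suc n) + g (suc n))) (sumTo-+ n f g) ⟩
    sumTo n f + sumTo n g + (f (suc n) + g (suc n))
      ≡⟨ interchange (sumTo n f) (sumTo n g) (f (suc n)) (g (suc n)) ⟩
    sumTo n f + f (suc n) + (sumTo n g + g (suc n)) ∎
    where
    open ≡-Reasoning
    interchange : ∀ a b c d → a + b + (c + d) ≡ a + c + (b + d)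
    interchange = solve-∀

  sumTo-*ˡ : ∀ n x (f : ℕ → ℤ) → sumTo n (λ a → x * f a) ≡ x * sumTo n f
  sumTo-*ˡ zero    x f = refl
  sumTo-*ˡ (suc n) x f =
    trans (cong (_+ x * f (suc n)) (sumTo-*ˡ n x f)) (sym (*-distribˡ-+ x (sumTo n f) (f (suc n))))

  δ-refl : ∀ m → δ m m ≡ + 1
  δ-refl m with m ≟ m
  ... | yes _   = refl
  ... | no  m≢m = ⊥-elim (m≢m refl)

  δ-≢ : ∀ {m n} → ¬ m ≡ n → δ m n ≡ + 0
  δ-≢ {m} {n} m≢n with m ≟ n
  ... | yes m≡n = ⊥-elim (m≢n m≡n)
  ... | no  _   = refl

  sumTo-δ-< : ∀ {m} n (f : ℕ → ℤ) → n < m → sumTo n (λ a → δ m a * f a) ≡ + 0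
  sumTo-δ-< zero    f 0<m = cong (_* f 0) (δ-≢ (λ m≡0 → <⇒≢ 0<m (sym m≡0)))
  sumTo-δ-< {m} (suc n) f n<m =
    cong₂ _+_ (sumTo-δ-< {m} n f (<-trans (n<1+n n) n<m))
              (cong (_* f (suc n)) (δ-≢ (λ m≡n → <⇒≢ n<m (sym m≡n))))

  sumTo-δ : ∀ {m} n (f : ℕ → ℤ) → m ≤ n → sumTo n (λ a → δ m a * f a) ≡ f m
  sumTo-δ zero f z≤n = *-identityˡ (f 0)
  sumTo-δ {m} (suc n) f m≤1+n with m ≤? n
  ... | yes m≤n = begin
    sumTo n (λ a → δ m a * f a) + δ m (suc n) * f (suc n)
      ≡⟨ cong₂ _+_ (sumTo-δ {m} n f m≤n)
                   (cong (_* f (suc n)) (δ-≢ (λ m≡1+n → <⇒≱ (s≤s m≤n) (≤-reflexive (sym m≡1+n))))) ⟩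
    f m + + 0
      ≡⟨ +-identityʳ (f m) ⟩
    f m ∎
    where open ≡-Reasoning
  ... | no m≰n with ≤-antisym m≤1+n (≰⇒> m≰n)
  ... | refl = begin
    sumTo n (λ a → δ (suc n) a * f a) + δ (suc n) (suc n) * f (suc n)
      ≡⟨ cong₂ _+_ (sumTo-δ-< {suc n} n f (n<1+n n)) (cong (_* f (suc n)) (δ-refl (suc n))) ⟩
    + 0 + + 1 * f (suc n)
      ≡⟨ trans (+-identityˡ _) (*-identityˡ (f (suc n))) ⟩
    f (suc n) ∎
    where open ≡-Reasoning

  shiftBy : ℕ → (ℕ → ℤ) → ℕ → ℤ
  shiftBy zero    h n       = h n
  shiftBy (suc m) h zero    = + 0
  shiftBy (suc m) h (suc n) = shiftBy m h n

  shiftBy-≤ : ∀ {m n} (h : ℕ → ℤ) → m ≤ n → shiftBy m h n ≡ h (n ∸ m)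
  shiftBy-≤ h z≤n       = refl
  shiftBy-≤ h (s≤s m≤n) = shiftBy-≤ h m≤n

  shiftBy-< : ∀ {m n} (h : ℕ → ℤ) → n < m → shiftBy m h n ≡ + 0
  shiftBy-< {suc m} {zero}  h _           = refl
  shiftBy-< {suc m} {suc n} h (s≤s n<m) = shiftBy-< h n<m

  sumTo-δ-shift : ∀ m n (h : ℕ → ℤ) → sumTo n (λ a → δ m a * h (n ∸ a)) ≡ shiftBy m h n
  sumTo-δ-shift m n h with m ≤? n
  ... | yes m≤n = trans (sumTo-δ n (λ a → h (n ∸ a)) m≤n) (sym (shiftBy-≤ h m≤n))
  ... | no  m≰n = trans (sumTo-δ-< n (λ a → h (n ∸ a)) (≰⇒> m≰n)) (sym (shiftBy-< h (≰⇒> m≰n)))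

  mono-⊛ : ∀ a b c (g : Poly) i j k →
    (mono a b c ⊛ g) i j k ≡ shiftBy a (λ i′ → shiftBy b (λ j′ → shiftBy c (g i′ j′) k) j) i
  mono-⊛ a b c g i j k = begin
    (sumTo i λ a′ → sumTo j λ b′ → sumTo k λ c′ →
       δ a a′ * (δ b b′ * δ c c′) * g (i ∸ a′) (j ∸ b′) (k ∸ c′))
      ≡⟨ sumTo-cong i (λ a′ → sumTo-cong j (λ b′ → sift-c a′ b′)) ⟩
    (sumTo i λ a′ → sumTo j λ b′ → δ a a′ * (δ b b′ * shiftBy c (g (i ∸ a′) (j ∸ b′)) k))
      ≡⟨ sumTo-cong i sift-b ⟩
    (sumTo i λ a′ → δ a a′ * shiftBy b (λ j′ → shiftBy c (g (i ∸ a′) j′) k) j)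
      ≡⟨ sumTo-δ-shift a i _ ⟩
    shiftBy a (λ i′ → shiftBy b (λ j′ → shiftBy c (g i′ j′) k) j) i ∎
    where
    open ≡-Reasoning
    reassoc : ∀ x y z w → x * (y * z) * w ≡ x * (y * (z * w))
    reassoc = solve-∀
    sift-c : ∀ a′ b′ →
      sumTo k (λ c′ → δ a a′ * (δ b b′ * δ c c′) * g (i ∸ a′) (j ∸ b′) (k ∸ c′))
                     ≡ δ a a′ * (δ b b′ * shiftBy c (g (i ∸ a′) (j ∸ b′)) k)
    sift-c a′ b′ = begin
      sumTo k (λ c′ → δ a a′ * (δ b b′ * δ c c′) * g (i ∸ a′) (j ∸ b′) (k ∸ c′))
        ≡⟨ sumTo-cong k (λ c′ → reassoc (δ a a′) (δ b b′) (δ c c′) _) ⟩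
      sumTo k (λ c′ → δ a a′ * (δ b b′ * (δ c c′ * g (i ∸ a′) (j ∸ b′) (k ∸ c′))))
        ≡⟨ sumTo-*ˡ k (δ a a′) _ ⟩
      δ a a′ * sumTo k (λ c′ → δ b b′ * (δ c c′ * g (i ∸ a′) (j ∸ b′) (k ∸ c′)))
        ≡⟨ cong (δ a a′ *_) (trans (sumTo-*ˡ k (δ b b′) _) (cong (δ b b′ *_) (sumTo-δ-shift c k _))) ⟩
      δ a a′ * (δ b b′ * shiftBy c (g (i ∸ a′) (j ∸ b′)) k) ∎
    sift-b : ∀ a′ → sumTo j (λ b′ → δ a a′ * (δ b b′ * shiftBy c (g (i ∸ a′) (j ∸ b′)) k))
                  ≡ δ a a′ * shiftBy b (λ j′ → shiftBy c (g (i ∸ a′) j′) k) j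
    sift-b a′ = trans (sumTo-*ˡ j (δ a a′) _) (cong (δ a a′ *_) (sumTo-δ-shift b j _))

  ⊛-distribʳ-⊕ : ∀ (f g h : Poly) i j k → ((f ⊕ g) ⊛ h) i j k ≡ (f ⊛ h) i j k + (g ⊛ h) i j k
  ⊛-distribʳ-⊕ f g h i j k =
    trans (sumTo-cong i λ a → trans (sumTo-cong j λ b →
             trans (sumTo-cong k λ c → *-distribʳ-+ (h (i ∸ a) (j ∸ b) (k ∸ c)) (f a b c) (g a b c))
                   (sumTo-+ k _ _))
           (sumTo-+ j _ _))
          (sumTo-+ i _ _)

  shiftX shiftY shiftZ : Poly → Poly
  shiftX g i j k = shiftBy 1 (λ i′ → g i′ j k) i
  shiftY g i j k = shiftBy 1 (λ j′ → g i j′ k) j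
  shiftZ g i j k = shiftBy 1 (g i j) k

  X-⊛ : ∀ g i j k → (X ⊛ g) i j k ≡ shiftX g i j k
  X-⊛ = mono-⊛ 1 0 0

  Y-⊛ : ∀ g i j k → (Y ⊛ g) i j k ≡ shiftY g i j k
  Y-⊛ = mono-⊛ 0 1 0

  Z-⊛ : ∀ g i j k → (Z ⊛ g) i j k ≡ shiftZ g i j k
  Z-⊛ = mono-⊛ 0 0 1

  include : Bool → ℤ → ℤ
  include true  x = x
  include false _ = + 0

  IsLinear : Bool → Bool → Bool → Poly → Set
  IsLinear u v w ℓ = ∀ g i j k →
    (ℓ ⊛ g) i j k ≡ include u (shiftX g i j k) + include v (shiftY g i j k) + include w (shiftZ g i j k)

  linear-XYZ : IsLinear true true true (X ⊕ Y ⊕ Z)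
  linear-XYZ g i j k = trans (⊛-distribʳ-⊕ (X ⊕ Y) Z g i j k)
    (cong₂ _+_ (trans (⊛-distribʳ-⊕ X Y g i j k) (cong₂ _+_ (X-⊛ g i j k) (Y-⊛ g i j k))) (Z-⊛ g i j k))

  linear-XY : IsLinear true true false (X ⊕ Y)
  linear-XY g i j k = trans (⊛-distribʳ-⊕ X Y g i j k)
    (trans (cong₂ _+_ (X-⊛ g i j k) (Y-⊛ g i j k)) (sym (+-identityʳ _)))

  linear-XZ : IsLinear true false true (X ⊕ Z)
  linear-XZ g i j k = trans (⊛-distribʳ-⊕ X Z g i j k)
    (cong₂ _+_ (trans (X-⊛ g i j k) (sym (+-identityʳ _))) (Z-⊛ g i j k))

  linear-YZ : IsLinear false true true (Y ⊕ Z)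
  linear-YZ g i j k = trans (⊛-distribʳ-⊕ Y Z g i j k)
    (cong₂ _+_ (trans (Y-⊛ g i j k) (sym (+-identityˡ _))) (Z-⊛ g i j k))

  linear-X : IsLinear true false false X
  linear-X g i j k = trans (X-⊛ g i j k) (sym (trans (+-identityʳ _) (+-identityʳ _)))

  linear-Y : IsLinear false true false Y
  linear-Y g i j k = trans (Y-⊛ g i j k) (sym (trans (+-identityʳ _) (+-identityˡ _)))

  linear-Z : IsLinear false false true Z
  linear-Z g i j k = trans (Z-⊛ g i j k) (sym (+-identityˡ _))

  trinomial : ℕ → Poly
  trinomial zero          = one
  trinomial (suc n) i j k = shiftX (trinomial n) i j k + shiftY (trinomial n) i j k + shiftZ (trinomial n) i j k

  -- An absent variable can only occur with exponent 0.
  support : Bool → ℕ → ℤ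
  support true  _ = + 1
  support false i = δ 0 i

  restrict : Bool → Bool → Bool → Poly → Poly
  restrict u v w c i j k = support u i * support v j * support w k * c i j k

  include-shiftX : ∀ u v w {P c : Poly} → (∀ i j k → P i j k ≡ restrict u v w c i j k) →
    ∀ i j k → include u (shiftX P i j k) ≡ restrict u v w (shiftX c) i j k
  include-shiftX true  v w P≗ zero    j k = sym (*-zeroʳ (+ 1 * support v j * support w k))
  include-shiftX false v w P≗ zero    j k = sym (*-zeroʳ (+ 1 * support v j * support w k))
  include-shiftX true  v w P≗ (suc i) j k = P≗ i j k
  include-shiftX false v w P≗ (suc i) j k = refl

  include-shiftY : ∀ u v w {P c : Poly} → (∀ i j k → P i j k ≡ restrict u v w c i j k) →
    ∀ i j k → include v (shiftY P i j k) ≡ restrict u v w (shiftY c) i j k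
  include-shiftY u true  w P≗ i zero    k = sym (*-zeroʳ (support u i * + 1 * support w k))
  include-shiftY u false w P≗ i zero    k = sym (*-zeroʳ (support u i * + 1 * support w k))
  include-shiftY u true  w P≗ i (suc j) k = P≗ i j k
  include-shiftY u false w {c = c} P≗ i (suc j) k =
    sym (cong (λ t → t * support w k * c i j k) (*-zeroʳ (support u i)))

  include-shiftZ : ∀ u v w {P c : Poly} → (∀ i j k → P i j k ≡ restrict u v w c i j k) →
    ∀ i j k → include w (shiftZ P i j k) ≡ restrict u v w (shiftZ c) i j k
  include-shiftZ u v true  P≗ i j zero    = sym (*-zeroʳ (support u i * support v j * + 1))
  include-shiftZ u v false P≗ i j zero    = sym (*-zeroʳ (support u i * support v j * + 1))
  include-shiftZ u v true  P≗ i j (suc k) = P≗ i j k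
  include-shiftZ u v false {c = c} P≗ i j (suc k) =
    sym (cong (_* c i j k) (*-zeroʳ (support u i * support v j)))

  support-δ₀ : ∀ u i → support u i * δ 0 i ≡ δ 0 i
  support-δ₀ true  zero    = refl
  support-δ₀ true  (suc i) = refl
  support-δ₀ false zero    = refl
  support-δ₀ false (suc i) = refl

  restrict-one : ∀ u v w i j k → restrict u v w one i j k ≡ one i j k
  restrict-one u v w i j k = begin
    su * sv * sw * (δ 0 i * (δ 0 j * δ 0 k))
      ≡⟨ regroup su sv sw (δ 0 i) (δ 0 j) (δ 0 k) ⟩
    su * δ 0 i * (sv * δ 0 j * (sw * δ 0 k))
      ≡⟨ cong₂ _*_ (support-δ₀ u i) (cong₂ _*_ (support-δ₀ v j) (support-δ₀ w k)) ⟩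
    δ 0 i * (δ 0 j * δ 0 k) ∎
    where
    open ≡-Reasoning
    su = support u i
    sv = support v j
    sw = support w k
    regroup : ∀ a b c x y z → a * b * c * (x * (y * z)) ≡ a * x * (b * y * (c * z))
    regroup = solve-∀

  ^ᵖ-linear : ∀ u v w {ℓ} → IsLinear u v w ℓ →
    ∀ n i j k → (ℓ ^ᵖ n) i j k ≡ restrict u v w (trinomial n) i j k
  ^ᵖ-linear u v w ℓ-linear zero    i j k = sym (restrict-one u v w i j k)
  ^ᵖ-linear u v w {ℓ} ℓ-linear (suc n) i j k = begin
    (ℓ ⊛ ℓ ^ᵖ n) i j k
      ≡⟨ ℓ-linear (ℓ ^ᵖ n) i j k ⟩
    include u (shiftX (ℓ ^ᵖ n) i j k) + include v (shiftY (ℓ ^ᵖ n) i j k) + include w (shiftZ (ℓ ^ᵖ n) i j k)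
      ≡⟨ cong₂ _+_ (cong₂ _+_ (include-shiftX u v w {c = trinomial n} IH i j k)
                              (include-shiftY u v w {c = trinomial n} IH i j k))
                   (include-shiftZ u v w {c = trinomial n} IH i j k) ⟩
    s * shiftX (trinomial n) i j k + s * shiftY (trinomial n) i j k + s * shiftZ (trinomial n) i j k
      ≡⟨ factor s (shiftX (trinomial n) i j k) (shiftY (trinomial n) i j k) (shiftZ (trinomial n) i j k) ⟩
    restrict u v w (trinomial (suc n)) i j k ∎
    where
    open ≡-Reasoning
    IH : ∀ i j k → (ℓ ^ᵖ n) i j k ≡ restrict u v w (trinomial n) i j k
    IH = ^ᵖ-linear u v w ℓ-linear n
    s = support u i * support v j * support w k
    factor : ∀ s a b c → s * a + s * b + s * c ≡ s * (a + b + c)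
    factor = solve-∀

  weight : ℕ → ℕ → ℕ → ℤ
  weight zero    zero    zero    = + 1
  weight (suc _) (suc _) (suc _) = + 1
  weight _       _       _       = + 0

  weight-δ : ∀ i j k → weight i j k ≡ (+ 1 - δ 0 i) * (+ 1 - δ 0 j) * (+ 1 - δ 0 k) + δ 0 i * δ 0 j * δ 0 k
  weight-δ zero    zero    zero    = refl
  weight-δ zero    zero    (suc k) = refl
  weight-δ zero    (suc j) zero    = refl
  weight-δ zero    (suc j) (suc k) = refl
  weight-δ (suc i) zero    zero    = refl
  weight-δ (suc i) zero    (suc k) = refl
  weight-δ (suc i) (suc j) zero    = refl
  weight-δ (suc i) (suc j) (suc k) = refl

  seqA-coefficient : ∀ n i j k → seqA n i j k ≡ weight i j k * trinomial n i j k
  seqA-coefficient n i j k = begin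
    seqA n i j k
      ≡⟨ cong₂ _+_ (cong₂ _+_ (cong₂ _+_ (cong₂ _-_ (cong₂ _-_ (cong₂ _-_
           (^ᵖ-linear true true true linear-XYZ n i j k) (^ᵖ-linear true true false linear-XY n i j k))
           (^ᵖ-linear true false true linear-XZ n i j k)) (^ᵖ-linear false true true linear-YZ n i j k))
           (^ᵖ-linear true false false linear-X n i j k)) (^ᵖ-linear false true false linear-Y n i j k))
           (^ᵖ-linear false false true linear-Z n i j k) ⟩
    + 1 * + 1 * + 1 * C - + 1 * + 1 * c * C - + 1 * b * + 1 * C - a * + 1 * + 1 * C
      + + 1 * b * c * C + a * + 1 * c * C + a * b * + 1 * C
      ≡⟨ inclusion-exclusion a b c C ⟩
    ((+ 1 - a) * (+ 1 - b) * (+ 1 - c) + a * b * c) * C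
      ≡⟨ cong (_* C) (sym (weight-δ i j k)) ⟩
    weight i j k * C ∎
    where
    open ≡-Reasoning
    a = δ 0 i
    b = δ 0 j
    c = δ 0 k
    C = trinomial n i j k
    inclusion-exclusion : ∀ a b c C →
      + 1 * + 1 * + 1 * C - + 1 * + 1 * c * C - + 1 * b * + 1 * C - a * + 1 * + 1 * C
        + + 1 * b * c * C + a * + 1 * c * C + a * b * + 1 * C
      ≡ ((+ 1 - a) * (+ 1 - b) * (+ 1 - c) + a * b * c) * C
    inclusion-exclusion = solve-∀

  shiftBy₁-cong : ∀ n {h h′ : ℕ → ℤ} → (∀ n′ → suc n′ ≡ n → h n′ ≡ h′ n′) →
    shiftBy 1 h n ≡ shiftBy 1 h′ n
  shiftBy₁-cong zero    _    = refl
  shiftBy₁-cong (suc n) h≗h′ = h≗h′ n refl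

  shiftBy-zero : ∀ m n → shiftBy m (λ _ → + 0) n ≡ + 0
  shiftBy-zero zero    n       = refl
  shiftBy-zero (suc m) zero    = refl
  shiftBy-zero (suc m) (suc n) = shiftBy-zero m n

open Coefficients

open import Data.Nat using (_+_; _*_; _^_; _!; _%_; _/_; _<?_; _≟_)
open import Data.Nat.Divisibility
  using (_∣_; _∣?_; _∣0; ∣⇒≤; ∣m⇒∣m*n; ∣n⇒∣m*n; m∣m*n; n∣m⇒m%n≡0; m%n≡0⇒n∣m)
open import Data.Nat.DivMod using (%-distribˡ-+; m≡m%n+[m/n]*n; m%n<n; [m+kn]%n≡m%n; m<n⇒m%n≡m)
open import Data.Nat.Induction using (<-rec)
open import Data.Nat.Primality using (Prime; euclidsLemma; prime⇒nonTrivial)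
open import Data.Nat.Properties
  using ( 0≢1+n; +-suc; suc-injective; +-identityʳ; *-identityˡ; *-identityʳ; *-distribˡ-+
        ; *-distribʳ-+; *-comm; +-assoc; +-comm; +-mono-≤; *-cancelʳ-≡; +-cancelˡ-≡
        ; m+n≡0⇒m≡0; m+n≡0⇒n≡0; m*n≡0⇒m≡0; <-cmp; <-irrefl; <⇒≤; ≤⇒≯; <⇒≱; <⇒≢
        ; <-≤-trans; ≤-reflexive; <-trans; ≤-trans; n<1+n; m≤m+n; m≤n+m; m<m+n; m<n+m; m<m*n; m^n>0 )
open import Data.Nat.Tactic.RingSolver using (solve-∀)
import Data.Integer as ℤ
import Data.Integer.Properties as ℤₚ
open import Data.Integer.Divisibility using () renaming (_∣_ to _∣ℤ_)
open import Data.Product using (_×_; _,_; ∃-syntax)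
open import Data.Sum as Sum using (_⊎_; inj₁; inj₂)
open import Function using (_∘_)
open import Function.Bundles using (_⇔_; mk⇔)
open import Relation.Binary using (tri<; tri≈; tri>)
open import Relation.Nullary.Decidable using (decidable-stable)

-- binom a b is the binomial coefficient (a + b choose a).
binom : ℕ → ℕ → ℕ
binom zero    b       = 1
binom (suc a) zero    = 1
binom (suc a) (suc b) = binom a (suc b) + binom (suc a) b

binom-0ʳ : ∀ a → binom a 0 ≡ 1
binom-0ʳ zero    = refl
binom-0ʳ (suc a) = refl

multinomial : ℕ → ℕ → ℕ → ℕ
multinomial i j k = binom i (j + k) * binom j k

multinomialᵖ : Poly
multinomialᵖ i j k = + multinomial i j k

multinomial-pascal : ∀ i j k → ¬ i + j + k ≡ 0 →
  shiftX multinomialᵖ i j k ℤ.+ shiftY multinomialᵖ i j k ℤ.+ shiftZ multinomialᵖ i j k ≡ multinomialᵖ i j k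
multinomial-pascal zero    zero    zero    ne = ⊥-elim (ne refl)
multinomial-pascal zero    zero    (suc k) _  = refl
multinomial-pascal zero    (suc j) zero    _  = cong +_ (trans (+-identityʳ _) (trans (*-identityˡ _) (binom-0ʳ j)))
multinomial-pascal zero    (suc j) (suc k) _  = cong +_ (sym (*-distribˡ-+ 1 (binom j (suc k)) (binom (suc j) k)))
multinomial-pascal (suc i) zero    zero    _  =
  cong +_ (trans (+-identityʳ _) (trans (+-identityʳ _) (cong (_* 1) (binom-0ʳ i))))
multinomial-pascal (suc i) zero    (suc k) _  = cong +_ (pascal (binom i (suc k)) (binom (suc i) k))
  where
  pascal : ∀ a b → a * 1 + 0 + b * 1 ≡ (a + b) * 1
  pascal = solve-∀
multinomial-pascal (suc i) (suc j) zero    _  =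
  cong +_ (trans (cong (λ t → A * 1 + B * t + 0) (binom-0ʳ j)) (pascal A B))
  where
  A = binom i (suc (j + 0))
  B = binom (suc i) (j + 0)
  pascal : ∀ a b → a * 1 + b * 1 + 0 ≡ (a + b) * 1
  pascal = solve-∀
multinomial-pascal (suc i) (suc j) (suc k) _  =
  cong +_ (trans (cong (λ t → A * (C + D) + B * C + binom (suc i) t * D) (sym (+-suc j k))) (pascal A B C D))
  where
  A = binom i (suc (j + suc k))
  B = binom (suc i) (j + suc k)
  C = binom j (suc k)
  D = binom (suc j) k
  pascal : ∀ A B C D → A * (C + D) + B * C + B * D ≡ (A + B) * (C + D)
  pascal = solve-∀

sum-shiftX : ∀ {i i′} j k → suc i′ ≡ i → i + j + k ≡ suc (i′ + j + k)
sum-shiftX j k refl = refl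

sum-shiftY : ∀ i {j j′} k → suc j′ ≡ j → i + j + k ≡ suc (i + j′ + k)
sum-shiftY i {j′ = j′} k refl = cong (_+ k) (+-suc i j′)

sum-shiftZ : ∀ i j {k k′} → suc k′ ≡ k → i + j + k ≡ suc (i + j + k′)
sum-shiftZ i j {k′ = k′} refl = +-suc (i + j) k′

trinomial-off : ∀ n i j k → ¬ i + j + k ≡ n → trinomial n i j k ≡ + 0
trinomial-off zero zero zero zero ne = ⊥-elim (ne refl)
trinomial-off zero zero zero (suc k) _ = refl
trinomial-off zero zero (suc j) k _ = refl
trinomial-off zero (suc i) j k _ = refl
trinomial-off (suc n) i j k ne = cong₂ ℤ._+_ (cong₂ ℤ._+_
  (trans (shiftBy₁-cong i λ i′ e → trinomial-off n i′ j k (ne ∘ trans (sum-shiftX j k e) ∘ cong suc))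
         (shiftBy-zero 1 i))
  (trans (shiftBy₁-cong j λ j′ e → trinomial-off n i j′ k (ne ∘ trans (sum-shiftY i k e) ∘ cong suc))
         (shiftBy-zero 1 j)))
  (trans (shiftBy₁-cong k λ k′ e → trinomial-off n i j k′ (ne ∘ trans (sum-shiftZ i j e) ∘ cong suc))
         (shiftBy-zero 1 k))

trinomial-on : ∀ n i j k → i + j + k ≡ n → trinomial n i j k ≡ multinomialᵖ i j k
trinomial-on zero zero zero zero _ = refl
trinomial-on (suc n) i j k e = trans (cong₂ ℤ._+_ (cong₂ ℤ._+_
  (shiftBy₁-cong i λ i′ e′ → trinomial-on n i′ j k (suc-injective (trans (sym (sum-shiftX j k e′)) e)))
  (shiftBy₁-cong j λ j′ e′ → trinomial-on n i j′ k (suc-injective (trans (sym (sum-shiftY i k e′)) e))))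
  (shiftBy₁-cong k λ k′ e′ → trinomial-on n i j k′ (suc-injective (trans (sym (sum-shiftZ i j e′)) e))))
  (multinomial-pascal i j k λ e₀ → 0≢1+n (trans (sym e₀) e))

seqA-interior : ∀ n {i j k} → 0 < i → 0 < j → 0 < k → i + j + k ≡ n → seqA n i j k ≡ + multinomial i j k
seqA-interior n {suc i} {suc j} {suc k} _ _ _ e =
  trans (seqA-coefficient n (suc i) (suc j) (suc k))
        (trans (ℤₚ.*-identityˡ _) (trinomial-on n (suc i) (suc j) (suc k) e))

seqA-off : ∀ n i j k → ¬ i + j + k ≡ n → seqA n i j k ≡ + 0
seqA-off n i j k ne =
  trans (seqA-coefficient n i j k)
        (trans (cong (weight i j k ℤ.*_) (trinomial-off n i j k ne)) (ℤₚ.*-zeroʳ (weight i j k)))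

seqA-face : ∀ n i j k → weight i j k ≡ + 0 → seqA n i j k ≡ + 0
seqA-face n i j k w≡0 = trans (seqA-coefficient n i j k) (cong (ℤ._* trinomial n i j k) w≡0)

binom-factorial : ∀ a b → binom a b * (a ! * b !) ≡ (a + b) !
binom-factorial zero    b       = trans (*-identityˡ _) (*-identityˡ _)
binom-factorial (suc a) zero    = trans (*-identityˡ _) (trans (*-identityʳ _) (cong _! (sym (+-identityʳ (suc a)))))
binom-factorial (suc a) (suc b) = begin
  (binom a (suc b) + binom (suc a) b) * ((suc a * a !) * (suc b * b !))
    ≡⟨ split (binom a (suc b)) (binom (suc a) b) a b (a !) (b !) ⟩
  suc a * (binom a (suc b) * (a ! * (suc b * b !))) + suc b * (binom (suc a) b * ((suc a * a !) * b !))
    ≡⟨ cong₂ (λ u v → suc a * u + suc b * v) (binom-factorial a (suc b))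
             (trans (binom-factorial (suc a) b) (cong _! (sym (+-suc a b)))) ⟩
  suc a * (a + suc b) ! + suc b * (a + suc b) !
    ≡⟨ collect a b ((a + suc b) !) ⟩
  suc (a + suc b) * (a + suc b) ! ∎
  where
  open ≡-Reasoning
  split : ∀ u v a b fa fb → (u + v) * ((suc a * fa) * (suc b * fb))
                          ≡ suc a * (u * (fa * (suc b * fb))) + suc b * (v * ((suc a * fa) * fb))
  split = solve-∀
  collect : ∀ a b n → suc a * n + suc b * n ≡ suc (a + suc b) * n
  collect = solve-∀

module Kummer (p-2 : ℕ) (p-prime : Prime (2 + p-2)) where

  p-1 p : ℕ
  p-1 = suc p-2
  p   = suc p-1

  0<p : 0 < p
  0<p = z<s

  1<p : 1 < p
  1<p = s<s z<s

  p-1<p : p-1 < p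
  p-1<p = n<1+n p-1

  p^-suc : ∀ m → p ^ suc m ≡ p ^ m * p
  p^-suc m = *-comm p (p ^ m)

  p∤1 : ¬ p ∣ 1
  p∤1 p∣1 with ∣⇒≤ p∣1
  ... | s≤s ()

  p∤! : ∀ m → m < p → ¬ p ∣ m !
  p∤! zero    _   = p∤1
  p∤! (suc m) m<p p∣m! with euclidsLemma (suc m) (m !) p-prime p∣m!
  ... | inj₁ p∣m = <⇒≱ m<p (∣⇒≤ p∣m)
  ... | inj₂ p∣m! = p∤! m (<-trans (n<1+n m) m<p) p∣m!

  p∤binom : ∀ r s → r + s < p → ¬ p ∣ binom r s
  p∤binom r s r+s<p p∣binom = p∤! (r + s) r+s<p
    (subst (p ∣_) (binom-factorial r s) (∣m⇒∣m*n (r ! * s !) p∣binom))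

  p∣binom : ∀ r s → suc r + suc s ≡ p → p ∣ binom (suc r) (suc s)
  p∣binom r s r+s≡p
    with euclidsLemma (binom (suc r) (suc s)) (suc r ! * suc s !) p-prime
           (subst (p ∣_) (sym (trans (binom-factorial (suc r) (suc s)) (cong _! r+s≡p))) (m∣m*n (p-1 !)))
  ... | inj₁ p∣binom = p∣binom
  ... | inj₂ p∣r!s! with euclidsLemma (suc r !) (suc s !) p-prime p∣r!s!
  ...   | inj₁ p∣r! = ⊥-elim (p∤! (suc r) (subst (suc r <_) r+s≡p (m<m+n (suc r) z<s)) p∣r!)
  ...   | inj₂ p∣s! = ⊥-elim (p∤! (suc s) (subst (suc s <_) r+s≡p (m<n+m (suc s) z<s)) p∣s!)

  lucasTerm : ℕ → ℕ → ℕ → ℕ → ℕ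
  lucasTerm r x s y with r + s <? p
  ... | yes _ = binom r s * binom x y
  ... | no  _ = 0

  lucasTerm-< : ∀ r x s y → r + s < p → lucasTerm r x s y ≡ binom r s * binom x y
  lucasTerm-< r x s y r+s<p with r + s <? p
  ... | yes _     = refl
  ... | no  r+s≮p = ⊥-elim (r+s≮p r+s<p)

  lucasTerm-≮ : ∀ r x s y → ¬ r + s < p → lucasTerm r x s y ≡ 0
  lucasTerm-≮ r x s y r+s≮p with r + s <? p
  ... | yes r+s<p = ⊥-elim (r+s≮p r+s<p)
  ... | no  _     = refl

  infix 4 _≡_[mod-p]
  record _≡_[mod-p] (a b : ℕ) : Set where
    constructor mod-p
    field %-≡ : a % p ≡ b % p

  ≡⇒≡[mod-p] : ∀ {a b} → a ≡ b → a ≡ b [mod-p]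
  ≡⇒≡[mod-p] a≡b = mod-p (cong (_% p) a≡b)

  ≡[mod-p]-trans : ∀ {a b c} → a ≡ b [mod-p] → b ≡ c [mod-p] → a ≡ c [mod-p]
  ≡[mod-p]-trans (mod-p a≡b) (mod-p b≡c) = mod-p (trans a≡b b≡c)

  ≡[mod-p]-+ : ∀ {a a′ b b′} → a ≡ a′ [mod-p] → b ≡ b′ [mod-p] → a + b ≡ a′ + b′ [mod-p]
  ≡[mod-p]-+ {a} {a′} {b} {b′} (mod-p a≡a′) (mod-p b≡b′) = mod-p
    (trans (%-distribˡ-+ a b p)
           (trans (cong₂ (λ u v → (u + v) % p) a≡a′ b≡b′) (sym (%-distribˡ-+ a′ b′ p))))

  ≡[mod-p]-sym : ∀ {a b} → a ≡ b [mod-p] → b ≡ a [mod-p]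
  ≡[mod-p]-sym (mod-p a≡b) = mod-p (sym a≡b)

  ∣⇒≡0[mod-p] : ∀ {a} → p ∣ a → a ≡ 0 [mod-p]
  ∣⇒≡0[mod-p] {a} p∣a = mod-p (n∣m⇒m%n≡0 a p p∣a)

  ≡[mod-p]-∣ : ∀ {a b} → a ≡ b [mod-p] → p ∣ a → p ∣ b
  ≡[mod-p]-∣ {a} {b} (mod-p a≡b) p∣a = m%n≡0⇒n∣m b p (trans (sym a≡b) (n∣m⇒m%n≡0 a p p∣a))

  lucasTerm-pascal-≤ : ∀ r x s y → suc r + suc s ≤ p →
    lucasTerm r x (suc s) y + lucasTerm (suc r) x s y ≡ binom (suc r) (suc s) * binom x y
  lucasTerm-pascal-≤ r x s y r+s≤p = begin
    lucasTerm r x (suc s) y + lucasTerm (suc r) x s y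
      ≡⟨ cong₂ _+_ (lucasTerm-< r x (suc s) y r+s≤p)
                   (lucasTerm-< (suc r) x s y (subst (_< p) (+-suc r s) r+s≤p)) ⟩
    binom r (suc s) * binom x y + binom (suc r) s * binom x y
      ≡⟨ sym (*-distribʳ-+ (binom x y) (binom r (suc s)) (binom (suc r) s)) ⟩
    binom (suc r) (suc s) * binom x y ∎
    where open ≡-Reasoning

  lucasTerm-pascal : ∀ r x s y →
    lucasTerm r x (suc s) y + lucasTerm (suc r) x s y ≡ lucasTerm (suc r) x (suc s) y [mod-p]
  lucasTerm-pascal r x s y with <-cmp (suc r + suc s) p
  ... | tri< r+s<p _ _ = ≡⇒≡[mod-p]
    (trans (lucasTerm-pascal-≤ r x s y (<⇒≤ r+s<p)) (sym (lucasTerm-< (suc r) x (suc s) y r+s<p)))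
  ... | tri≈ _ r+s≡p _ = ≡[mod-p]-trans (≡⇒≡[mod-p] (lucasTerm-pascal-≤ r x s y (≤-reflexive r+s≡p)))
    (≡[mod-p]-trans (∣⇒≡0[mod-p] (∣m⇒∣m*n (binom x y) (p∣binom r s r+s≡p)))
                    (≡⇒≡[mod-p] (sym (lucasTerm-≮ (suc r) x (suc s) y (<-irrefl r+s≡p)))))
  ... | tri> _ _ p<r+s = ≡⇒≡[mod-p] (trans
    (cong₂ _+_ (lucasTerm-≮ r x (suc s) y (<⇒≱ p<r+s))
               (lucasTerm-≮ (suc r) x s y (<⇒≱ p<r+s ∘ subst (_< p) (sym (+-suc r s)))))
    (sym (lucasTerm-≮ (suc r) x (suc s) y (<⇒≱ p<r+s ∘ <⇒≤))))

  lucasTerm-borrowˡ : ∀ x s y → suc s < p →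
    lucasTerm p-1 x (suc s) y + lucasTerm 0 (suc x) s y ≡ lucasTerm 0 (suc x) (suc s) y
  lucasTerm-borrowˡ x s y s<p = trans
    (cong₂ _+_ (lucasTerm-≮ p-1 x (suc s) y (≤⇒≯ (subst (p ≤_) (sym (+-suc p-1 s)) (s≤s (m≤m+n p-1 s)))))
               (lucasTerm-< 0 (suc x) s y (<⇒≤ s<p)))
    (sym (lucasTerm-< 0 (suc x) (suc s) y s<p))

  lucasTerm-borrowʳ : ∀ r x y → suc r < p →
    lucasTerm r x 0 (suc y) + lucasTerm (suc r) x p-1 y ≡ lucasTerm (suc r) x 0 (suc y)
  lucasTerm-borrowʳ r x y r<p = begin
    lucasTerm r x 0 (suc y) + lucasTerm (suc r) x p-1 y
      ≡⟨ cong₂ _+_ (lucasTerm-< r x 0 (suc y) (subst (_< p) (sym (+-identityʳ r)) (<⇒≤ r<p)))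
                   (lucasTerm-≮ (suc r) x p-1 y (≤⇒≯ (s≤s (m≤n+m p-1 r)))) ⟩
    binom r 0 * binom x (suc y) + 0
      ≡⟨ trans (+-identityʳ _) (cong (_* binom x (suc y)) (binom-0ʳ r)) ⟩
    binom (suc r) 0 * binom x (suc y)
      ≡⟨ sym (lucasTerm-< (suc r) x 0 (suc y) (subst (_< p) (sym (+-identityʳ (suc r))) r<p)) ⟩
    lucasTerm (suc r) x 0 (suc y) ∎
    where open ≡-Reasoning

  lucasTerm-borrow² : ∀ x y →
    lucasTerm p-1 x 0 (suc y) + lucasTerm 0 (suc x) p-1 y ≡ lucasTerm 0 (suc x) 0 (suc y)
  lucasTerm-borrow² x y = begin
    lucasTerm p-1 x 0 (suc y) + lucasTerm 0 (suc x) p-1 y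
      ≡⟨ cong₂ _+_ (lucasTerm-< p-1 x 0 (suc y) (subst (_< p) (sym (+-identityʳ p-1)) p-1<p))
                   (lucasTerm-< 0 (suc x) p-1 y p-1<p) ⟩
    1 * binom x (suc y) + 1 * binom (suc x) y
      ≡⟨ sym (*-distribˡ-+ 1 (binom x (suc y)) (binom (suc x) y)) ⟩
    1 * binom (suc x) (suc y)
      ≡⟨ sym (lucasTerm-< 0 (suc x) 0 (suc y) 0<p) ⟩
    lucasTerm 0 (suc x) 0 (suc y) ∎
    where open ≡-Reasoning

  -- Induction along Pascal's rule: lowering a last digit that is already 0 borrows from the next digit.
  binom-lucas : ∀ a b {r x s y} → a ≡ r + x * p → b ≡ s + y * p → r < p → s < p →
    binom a b ≡ lucasTerm r x s y [mod-p]
  binom-lucas zero b {r} {x} {s} {y} a≡ _ _ s<p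
    with m+n≡0⇒m≡0 r (sym a≡) | m*n≡0⇒m≡0 x p (m+n≡0⇒n≡0 r (sym a≡))
  ... | refl | refl = ≡⇒≡[mod-p] (sym (lucasTerm-< 0 0 s y s<p))
  binom-lucas (suc a) zero {r} {x} {s} {y} _ b≡ r<p _
    with m+n≡0⇒m≡0 s (sym b≡) | m*n≡0⇒m≡0 y p (m+n≡0⇒n≡0 s (sym b≡))
  ... | refl | refl = ≡⇒≡[mod-p] (sym (trans (lucasTerm-< r x 0 0 (subst (_< p) (sym (+-identityʳ r)) r<p))
                                              (cong₂ _*_ (binom-0ʳ r) (binom-0ʳ x))))
  binom-lucas (suc a) (suc b) {suc r} {x} {suc s} {y} a≡ b≡ r<p s<p = ≡[mod-p]-trans
    (≡[mod-p]-+ (binom-lucas a (suc b) (suc-injective a≡) b≡ (<⇒≤ r<p) s<p)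
                (binom-lucas (suc a) b a≡ (suc-injective b≡) r<p (<⇒≤ s<p)))
    (lucasTerm-pascal r x s y)
  binom-lucas (suc a) (suc b) {zero} {suc x} {suc s} {y} a≡ b≡ _ s<p = ≡[mod-p]-trans
    (≡[mod-p]-+ (binom-lucas a (suc b) (suc-injective a≡) b≡ p-1<p s<p)
                (binom-lucas (suc a) b a≡ (suc-injective b≡) 0<p (<⇒≤ s<p)))
    (≡⇒≡[mod-p] (lucasTerm-borrowˡ x s y s<p))
  binom-lucas (suc a) (suc b) {suc r} {x} {zero} {suc y} a≡ b≡ r<p _ = ≡[mod-p]-trans
    (≡[mod-p]-+ (binom-lucas a (suc b) (suc-injective a≡) b≡ (<⇒≤ r<p) 0<p)
                (binom-lucas (suc a) b a≡ (suc-injective b≡) r<p p-1<p))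
    (≡⇒≡[mod-p] (lucasTerm-borrowʳ r x y r<p))
  binom-lucas (suc a) (suc b) {zero} {suc x} {zero} {suc y} a≡ b≡ _ _ = ≡[mod-p]-trans
    (≡[mod-p]-+ (binom-lucas a (suc b) (suc-injective a≡) b≡ p-1<p 0<p)
                (binom-lucas (suc a) b a≡ (suc-injective b≡) 0<p p-1<p))
    (≡⇒≡[mod-p] (lucasTerm-borrow² x y))

  -- By Kummer's theorem this says that adding a and b in base p produces no carry.
  NoCarry : ℕ → ℕ → Set
  NoCarry a b = ¬ p ∣ binom a b

  noCarry⇒digits : ∀ r x s y → r < p → s < p → NoCarry (r + x * p) (s + y * p) → r + s < p × NoCarry x y
  noCarry⇒digits r x s y r<p s<p p∤ab with r + s <? p
  ... | no r+s≮p = ⊥-elim (p∤ab (≡[mod-p]-∣ (≡[mod-p]-sym (binom-lucas _ _ refl refl r<p s<p))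
                                           (subst (p ∣_) (sym (lucasTerm-≮ r x s y r+s≮p)) (p ∣0))))
  ... | yes r+s<p = r+s<p , λ p∣xy → p∤ab (≡[mod-p]-∣ (≡[mod-p]-sym (binom-lucas _ _ refl refl r<p s<p))
    (subst (p ∣_) (sym (lucasTerm-< r x s y r+s<p)) (∣n⇒∣m*n (binom r s) p∣xy)))

  digits⇒noCarry : ∀ r x s y → r < p → s < p → r + s < p → NoCarry x y → NoCarry (r + x * p) (s + y * p)
  digits⇒noCarry r x s y r<p s<p r+s<p p∤xy p∣ab
    with euclidsLemma (binom r s) (binom x y) p-prime
           (subst (p ∣_) (lucasTerm-< r x s y r+s<p) (≡[mod-p]-∣ (binom-lucas _ _ refl refl r<p s<p) p∣ab))
  ... | inj₁ p∣rs = p∤binom r s r+s<p p∣rs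
  ... | inj₂ p∣xy = p∤xy p∣xy

  data Digits : ℕ → Set where
    digits : ∀ r x → r < p → Digits (r + x * p)

  digits-of : ∀ n → Digits n
  digits-of n = subst Digits (sym (m≡m%n+[m/n]*n n p)) (digits (n % p) (n / p) (m%n<n n p))

  digits-unique : ∀ {r x r′ x′} → r < p → r′ < p → r + x * p ≡ r′ + x′ * p → r ≡ r′ × x ≡ x′
  digits-unique {r} {x} {r′} {x′} r<p r′<p eq =
    r≡r′ , *-cancelʳ-≡ x x′ p (+-cancelˡ-≡ r _ _ (trans eq (cong (_+ x′ * p) (sym r≡r′))))
    where
    r≡r′ : r ≡ r′
    r≡r′ = begin
      r                 ≡⟨ sym (m<n⇒m%n≡m r<p) ⟩
      r % p             ≡⟨ sym ([m+kn]%n≡m%n r x p) ⟩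
      (r + x * p) % p   ≡⟨ cong (_% p) eq ⟩
      (r′ + x′ * p) % p ≡⟨ [m+kn]%n≡m%n r′ x′ p ⟩
      r′ % p            ≡⟨ m<n⇒m%n≡m r′<p ⟩
      r′ ∎
      where open ≡-Reasoning

  +-digitwise : ∀ r x s y → r + x * p + (s + y * p) ≡ r + s + (x + y) * p
  +-digitwise r x s y = regroup r x s y p
    where
    regroup : ∀ r x s y p → r + x * p + (s + y * p) ≡ r + s + (x + y) * p
    regroup = solve-∀

  positive-quotient : ∀ x → 0 < x * p → 0 < x
  positive-quotient (suc x) _ = z<s

  positive-multiple : ∀ {x} → 0 < x → 0 < x * p
  positive-multiple {suc x} _ = z<s

  positive-digit : ∀ r → 0 < r + 0 * p → 0 < r
  positive-digit r 0<r+0 = subst (0 <_) (+-identityʳ r) 0<r+0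

  power-carries : ∀ m {a b} → 0 < a → 0 < b → a + b ≡ p ^ m → ¬ NoCarry a b
  power-carries zero 0<a 0<b a+b≡1 _ = <-irrefl refl (subst (1 <_) a+b≡1 (+-mono-≤ 0<a 0<b))
  power-carries (suc m) {a} {b} 0<a 0<b a+b≡pᵐ⁺¹ p∤ab with digits-of a | digits-of b
  ... | digits r x r<p | digits s y s<p with noCarry⇒digits r x s y r<p s<p p∤ab
  ... | r+s<p , p∤xy
    with digits-unique {r + s} {x + y} {0} {p ^ m} r+s<p 0<p
           (trans (sym (+-digitwise r x s y)) (trans a+b≡pᵐ⁺¹ (p^-suc m)))
  ... | r+s≡0 , x+y≡pᵐ with m+n≡0⇒m≡0 r r+s≡0 | m+n≡0⇒n≡0 r r+s≡0
  ... | refl | refl = power-carries m (positive-quotient x 0<a) (positive-quotient y 0<b) x+y≡pᵐ p∤xy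

  noCarry₃⇒digits : ∀ r x s y t z → r < p → s < p → t < p →
    NoCarry (r + x * p) (s + y * p + (t + z * p)) → NoCarry (s + y * p) (t + z * p) →
    r + (s + t) < p × NoCarry x (y + z) × NoCarry y z
  noCarry₃⇒digits r x s y t z r<p s<p t<p p∤a[bc] p∤bc with noCarry⇒digits s y t z s<p t<p p∤bc
  ... | s+t<p , p∤yz
    with noCarry⇒digits r x (s + t) (y + z) r<p s+t<p (subst (NoCarry (r + x * p)) (+-digitwise s y t z) p∤a[bc])
  ... | R<p , p∤x[yz] = R<p , p∤x[yz] , p∤yz

  +-digitwise₃ : ∀ r x s y t z → r + x * p + (s + y * p) + (t + z * p) ≡ r + (s + t) + (x + (y + z)) * p
  +-digitwise₃ r x s y t z = regroup r x s y t z p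
    where
    regroup : ∀ r x s y t z p → r + x * p + (s + y * p) + (t + z * p) ≡ r + (s + t) + (x + (y + z)) * p
    regroup = solve-∀

  onePlusPower-carries : ∀ l {a b c} → 0 < a → 0 < b → 0 < c → a + b + c ≡ 1 + p ^ suc l →
    ¬ (NoCarry a (b + c) × NoCarry b c)
  onePlusPower-carries l {a} {b} {c} 0<a 0<b 0<c a+b+c≡ (p∤a[bc] , p∤bc)
    with digits-of a | digits-of b | digits-of c
  ... | digits r x r<p | digits s y s<p | digits t z t<p
    with noCarry₃⇒digits r x s y t z r<p s<p t<p p∤a[bc] p∤bc
  ... | R<p , p∤x[yz] , p∤yz
    with digits-unique {r + (s + t)} {x + (y + z)} {1} {p ^ l} R<p 1<p
           (trans (sym (+-digitwise₃ r x s y t z)) (trans a+b+c≡ (cong suc (p^-suc l))))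
  ... | R≡1 , X≡pˡ = carry r x s y t z 0<a 0<b 0<c R≡1 X≡pˡ p∤x[yz] p∤yz
    where
    -- The last digits sum to 1, so at most one of a, b, c is not a multiple of p; dividing the others
    -- by p gives a carry-free split of p ^ l, either x + (y + z) or y + z.
    carry : ∀ r x s y t z → 0 < r + x * p → 0 < s + y * p → 0 < t + z * p →
      r + (s + t) ≡ 1 → x + (y + z) ≡ p ^ l → NoCarry x (y + z) → NoCarry y z → ⊥
    carry r x s zero t zero _ 0<b 0<c R≡1 _ _ _ =
      <-irrefl refl (subst (1 <_) R≡1
        (≤-trans (+-mono-≤ (positive-digit s 0<b) (positive-digit t 0<c)) (m≤n+m (s + t) r)))
    carry r (suc x) s (suc y) t z _ _ _ _ X≡pˡ p∤x[yz] _ = power-carries l z<s z<s X≡pˡ p∤x[yz]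
    carry r (suc x) s zero t (suc z) _ _ _ _ X≡pˡ p∤x[yz] _ = power-carries l z<s z<s X≡pˡ p∤x[yz]
    carry 1 zero 0 y 0 z _ 0<b 0<c _ X≡pˡ _ p∤yz =
      power-carries l (positive-quotient y 0<b) (positive-quotient z 0<c) X≡pˡ p∤yz

  twoPowers-carries : ∀ m l {a b c} → 0 < a → 0 < b → 0 < c → a + b + c ≡ p ^ m + p ^ l →
    ¬ (NoCarry a (b + c) × NoCarry b c)
  twoPowers-carries zero zero 0<a 0<b 0<c a+b+c≡2 _ =
    <-irrefl refl (subst (2 <_) a+b+c≡2 (+-mono-≤ (+-mono-≤ 0<a 0<b) 0<c))
  twoPowers-carries zero (suc l) 0<a 0<b 0<c a+b+c≡ = onePlusPower-carries l 0<a 0<b 0<c a+b+c≡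
  twoPowers-carries (suc m) zero 0<a 0<b 0<c a+b+c≡ =
    onePlusPower-carries m 0<a 0<b 0<c (trans a+b+c≡ (+-comm (p ^ suc m) 1))
  twoPowers-carries (suc m) (suc l) {a} {b} {c} 0<a 0<b 0<c a+b+c≡ (p∤a[bc] , p∤bc)
    with digits-of a | digits-of b | digits-of c
  ... | digits r x r<p | digits s y s<p | digits t z t<p
    with noCarry₃⇒digits r x s y t z r<p s<p t<p p∤a[bc] p∤bc
  ... | R<p , p∤x[yz] , p∤yz
    with digits-unique {r + (s + t)} {x + (y + z)} {0} {p ^ m + p ^ l} R<p 0<p
           (trans (sym (+-digitwise₃ r x s y t z)) (trans a+b+c≡
             (trans (cong₂ _+_ (p^-suc m) (p^-suc l)) (sym (*-distribʳ-+ p (p ^ m) (p ^ l))))))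
  ... | R≡0 , X≡ = carry r x s y t z 0<a 0<b 0<c R≡0 X≡ p∤x[yz] p∤yz
    where
    carry : ∀ r x s y t z → 0 < r + x * p → 0 < s + y * p → 0 < t + z * p →
      r + (s + t) ≡ 0 → x + (y + z) ≡ p ^ m + p ^ l → NoCarry x (y + z) → NoCarry y z → ⊥
    carry 0 x 0 y 0 z 0<a 0<b 0<c _ X≡ p∤x[yz] p∤yz = twoPowers-carries m l
      (positive-quotient x 0<a) (positive-quotient y 0<b) (positive-quotient z 0<c)
      (trans (+-assoc x y z) X≡) (p∤x[yz] , p∤yz)

  IsPower IsSumOfTwoPowers NoCarrySplit₂ NoCarrySplit₃ : ℕ → Set
  IsPower n = ∃[ m ] n ≡ p ^ m
  IsSumOfTwoPowers n = ∃[ m ] ∃[ l ] n ≡ p ^ m + p ^ l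
  NoCarrySplit₂ n = ∃[ a ] ∃[ b ] 0 < a × 0 < b × a + b ≡ n × NoCarry a b
  NoCarrySplit₃ n =
    ∃[ a ] ∃[ b ] ∃[ c ] 0 < a × 0 < b × 0 < c × a + b + c ≡ n × NoCarry a (b + c) × NoCarry b c

  PowerOrSumOfTwoPowers : ℕ → Set
  PowerOrSumOfTwoPowers n = IsPower n ⊎ IsSumOfTwoPowers n

  noCarry-*p : ∀ a b → NoCarry a b → NoCarry (a * p) (b * p)
  noCarry-*p a b = digits⇒noCarry 0 a 0 b 0<p 0<p 0<p

  noCarry-digit-multiple : ∀ r q → r < p → NoCarry r (q * p)
  noCarry-digit-multiple r q r<p = subst (λ a → NoCarry a (q * p)) (+-identityʳ r)
    (digits⇒noCarry r 0 0 q r<p 0<p (subst (_< p) (sym (+-identityʳ r)) r<p) p∤1)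

  quotient< : ∀ r q → suc q < r + suc q * p
  quotient< r q = <-≤-trans (m<m*n (suc q) p 1<p) (m≤n+m (suc q * p) r)

  isPower-*p : ∀ {q} → IsPower q → IsPower (q * p)
  isPower-*p (m , q≡pᵐ) = suc m , trans (cong (_* p) q≡pᵐ) (sym (p^-suc m))

  powerOrSumOfTwo-*p : ∀ {q} → PowerOrSumOfTwoPowers q → PowerOrSumOfTwoPowers (q * p)
  powerOrSumOfTwo-*p (inj₁ power) = inj₁ (isPower-*p power)
  powerOrSumOfTwo-*p (inj₂ (m , l , q≡pᵐ+pˡ)) = inj₂ (suc m , suc l ,
    trans (cong (_* p) q≡pᵐ+pˡ) (trans (*-distribʳ-+ p (p ^ m) (p ^ l)) (sym (cong₂ _+_ (p^-suc m) (p^-suc l)))))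

  noCarrySplit₂-*p : ∀ {q} → NoCarrySplit₂ q → NoCarrySplit₂ (q * p)
  noCarrySplit₂-*p (a , b , 0<a , 0<b , a+b≡q , p∤ab) =
    a * p , b * p , positive-multiple 0<a , positive-multiple 0<b ,
    trans (sym (*-distribʳ-+ p a b)) (cong (_* p) a+b≡q) , noCarry-*p a b p∤ab

  noCarrySplit₃-*p : ∀ {q} → NoCarrySplit₃ q → NoCarrySplit₃ (q * p)
  noCarrySplit₃-*p (a , b , c , 0<a , 0<b , 0<c , a+b+c≡q , p∤a[bc] , p∤bc) =
    a * p , b * p , c * p , positive-multiple 0<a , positive-multiple 0<b , positive-multiple 0<c ,
    trans (distrib a b c p) (cong (_* p) a+b+c≡q) ,
    subst (NoCarry (a * p)) (*-distribʳ-+ p b c) (noCarry-*p a (b + c) p∤a[bc]) , noCarry-*p b c p∤bc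
    where
    distrib : ∀ a b c p → a * p + b * p + c * p ≡ (a + b + c) * p
    distrib = solve-∀

  power⊎noCarrySplit₂ : ∀ n → 0 < n → IsPower n ⊎ NoCarrySplit₂ n
  power⊎noCarrySplit₂ = <-rec _ split
    where
    split : ∀ n → (∀ {q} → q < n → 0 < q → IsPower q ⊎ NoCarrySplit₂ q) →
      0 < n → IsPower n ⊎ NoCarrySplit₂ n
    split n rec 0<n with digits-of n
    ... | digits 1 zero _ = inj₁ (0 , refl)
    ... | digits (suc (suc r)) zero r<p =
      inj₂ (1 , suc r , z<s , z<s , sym (+-identityʳ _) , p∤binom 1 (suc r) r<p)
    ... | digits zero (suc q) _ = Sum.map isPower-*p noCarrySplit₂-*p (rec (quotient< 0 q) z<s)
    ... | digits (suc r) (suc q) r<p =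
      inj₂ (suc r , suc q * p , z<s , positive-multiple {suc q} z<s , refl ,
            noCarry-digit-multiple (suc r) (suc q) r<p)

  powerOrSumOfTwo⊎noCarrySplit₃ : ∀ n → 0 < n → PowerOrSumOfTwoPowers n ⊎ NoCarrySplit₃ n
  powerOrSumOfTwo⊎noCarrySplit₃ = <-rec _ split
    where
    split : ∀ n → (∀ {q} → q < n → 0 < q → PowerOrSumOfTwoPowers q ⊎ NoCarrySplit₃ q) → 0 < n →
      PowerOrSumOfTwoPowers n ⊎ NoCarrySplit₃ n
    split n rec 0<n with digits-of n
    ... | digits 1 zero _ = inj₁ (inj₁ (0 , refl))
    ... | digits 2 zero _ = inj₁ (inj₂ (0 , 0 , refl))
    ... | digits (suc (suc (suc r))) zero r<p =
      inj₂ (1 , 1 , suc r , z<s , z<s , z<s , sym (+-identityʳ _) ,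
            p∤binom 1 (suc (suc r)) r<p , p∤binom 1 (suc r) (<⇒≤ r<p))
    ... | digits zero (suc q) _ = Sum.map powerOrSumOfTwo-*p noCarrySplit₃-*p (rec (quotient< 0 q) z<s)
    split n rec 0<n | digits (suc r) (suc q) r<p with power⊎noCarrySplit₂ (suc q) z<s | r
    ... | inj₁ (m , q≡pᵐ) | zero =
      inj₁ (inj₂ (0 , suc m , cong suc (trans (cong (_* p) q≡pᵐ) (sym (p^-suc m)))))
    ... | inj₁ _ | suc r′ =
      inj₂ (1 , suc r′ , suc q * p , z<s , z<s , positive-multiple {suc q} z<s , refl ,
            digits⇒noCarry 1 0 (suc r′) (suc q) 1<p (<⇒≤ r<p) r<p p∤1 ,
            noCarry-digit-multiple (suc r′) (suc q) (<⇒≤ r<p))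
    ... | inj₂ (s , t , 0<s , 0<t , s+t≡q , p∤st) | r′ =
      inj₂ (suc r′ , s * p , t * p , z<s , positive-multiple 0<s , positive-multiple 0<t ,
            trans (+-assoc (suc r′) (s * p) (t * p))
                  (cong (λ u → suc r′ + u) (trans (sym (*-distribʳ-+ p s t)) (cong (_* p) s+t≡q))) ,
            subst (NoCarry (suc r′)) (*-distribʳ-+ p s t) (noCarry-digit-multiple (suc r′) (s + t) r<p) ,
            noCarry-*p s t p∤st)

  noCarry⇒p∤multinomial : ∀ i j k → NoCarry i (j + k) → NoCarry j k → ¬ p ∣ multinomial i j k
  noCarry⇒p∤multinomial i j k p∤i[jk] p∤jk p∣ijk with euclidsLemma (binom i (j + k)) (binom j k) p-prime p∣ijk
  ... | inj₁ p∣i[jk] = p∤i[jk] p∣i[jk]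
  ... | inj₂ p∣jk    = p∤jk p∣jk

  p∤multinomial⇒noCarry : ∀ i j k → ¬ p ∣ multinomial i j k → NoCarry i (j + k) × NoCarry j k
  p∤multinomial⇒noCarry i j k p∤ijk =
    p∤ijk ∘ ∣m⇒∣m*n (binom j k) , p∤ijk ∘ ∣n⇒∣m*n (binom i (j + k))

  carries : ∀ {n i j k} → PowerOrSumOfTwoPowers n → 0 < i → 0 < j → 0 < k → i + j + k ≡ n →
    ¬ (NoCarry i (j + k) × NoCarry j k)
  carries {i = i} {j} {k} (inj₁ (m , n≡pᵐ)) 0<i 0<j 0<k i+j+k≡n (p∤i[jk] , _) =
    power-carries m 0<i (≤-trans 0<j (m≤m+n j k)) (trans (sym (+-assoc i j k)) (trans i+j+k≡n n≡pᵐ)) p∤i[jk]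
  carries (inj₂ (m , l , n≡pᵐ+pˡ)) 0<i 0<j 0<k i+j+k≡n =
    twoPowers-carries m l 0<i 0<j 0<k (trans i+j+k≡n n≡pᵐ+pˡ)

  powerOrSumOfTwo-positive : ∀ {n} → PowerOrSumOfTwoPowers n → 0 < n
  powerOrSumOfTwo-positive (inj₁ (m , refl)) = m^n>0 p m
  powerOrSumOfTwo-positive (inj₂ (m , l , refl)) = ≤-trans (m^n>0 p m) (m≤m+n (p ^ m) (p ^ l))

  zeroSet⇒powers : ∀ n → InZeroSet p n → PowerOrSumOfTwoPowers n
  zeroSet⇒powers zero p∣a₀ = ⊥-elim (p∤1 (subst (+ p ∣ℤ_) (seqA-coefficient 0 0 0 0) (p∣a₀ 0 0 0)))
  zeroSet⇒powers (suc n) p∣a with powerOrSumOfTwo⊎noCarrySplit₃ (suc n) z<s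
  ... | inj₁ powers = powers
  ... | inj₂ (a , b , c , 0<a , 0<b , 0<c , a+b+c≡n , p∤a[bc] , p∤bc) =
    ⊥-elim (noCarry⇒p∤multinomial a b c p∤a[bc] p∤bc
             (subst (+ p ∣ℤ_) (seqA-interior (suc n) 0<a 0<b 0<c a+b+c≡n) (p∣a a b c)))

  powers⇒zeroSet : ∀ n → PowerOrSumOfTwoPowers n → InZeroSet p n
  powers⇒zeroSet n powers zero zero zero =
    subst (+ p ∣ℤ_) (sym (seqA-off n 0 0 0 (<⇒≢ (powerOrSumOfTwo-positive powers)))) (p ∣0)
  powers⇒zeroSet n powers (suc i) (suc j) (suc k) with suc i + suc j + suc k ≟ n
  ... | no  off = subst (+ p ∣ℤ_) (sym (seqA-off n (suc i) (suc j) (suc k) off)) (p ∣0)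
  ... | yes on  = subst (+ p ∣ℤ_) (sym (seqA-interior n z<s z<s z<s on))
    (decidable-stable (p ∣? _)
      (carries powers z<s z<s z<s on ∘ p∤multinomial⇒noCarry (suc i) (suc j) (suc k)))
  powers⇒zeroSet n _ zero    zero    (suc k) = subst (+ p ∣ℤ_) (sym (seqA-face n 0 0 (suc k) refl)) (p ∣0)
  powers⇒zeroSet n _ zero    (suc j) zero    = subst (+ p ∣ℤ_) (sym (seqA-face n 0 (suc j) 0 refl)) (p ∣0)
  powers⇒zeroSet n _ zero    (suc j) (suc k) = subst (+ p ∣ℤ_) (sym (seqA-face n 0 (suc j) (suc k) refl)) (p ∣0)
  powers⇒zeroSet n _ (suc i) zero    zero    = subst (+ p ∣ℤ_) (sym (seqA-face n (suc i) 0 0 refl)) (p ∣0)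
  powers⇒zeroSet n _ (suc i) zero    (suc k) = subst (+ p ∣ℤ_) (sym (seqA-face n (suc i) 0 (suc k) refl)) (p ∣0)
  powers⇒zeroSet n _ (suc i) (suc j) zero    = subst (+ p ∣ℤ_) (sym (seqA-face n (suc i) (suc j) 0 refl)) (p ∣0)

proposition3p2 : (p : ℕ) → Prime p → (n : ℕ) →
    InZeroSet p n ⇔ ((∃[ m ] n ≡ p ^ m) ⊎ (∃[ m ] ∃[ k ] n ≡ p ^ m + p ^ k))
proposition3p2 zero p-prime _ with prime⇒nonTrivial p-prime
... | ()
proposition3p2 (suc zero) p-prime _ with prime⇒nonTrivial p-prime
... | ()
proposition3p2 (suc (suc p-2)) p-prime n = mk⇔ (zeroSet⇒powers n) (powers⇒zeroSet n)
  where open Kummer p-2 p-prime
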